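{- Let $Z$ be a set, $\mathcal{Y}\subseteq\mathcal{P}(Z)$ (no closure conditions assumed), and $\mu:\mathcal{Y}\to\mathcal{P}(Z)$. Then there is a $\mathcal{Y}$-smooth preferential structure $\mathcal{Z}$ over $Z$ such that $\mu(X)=\mu_{\mathcal{Z}}(X)$ for all $X\in\mathcal{Y}$ if and only if $\mu$ satisfies $(\mu\subseteq)$ and (HUx).
   Context: $(\mu\subseteq)$: $\mu(X)\subseteq X$ for all $X\in\mathcal{Y}$. For $U\in\mathcal{Y}$, $x\in Z$: $H(U,x)_0:=U$; $H(U,x)_{\alpha+1}:=H(U,x)_\alpha\cup\bigcup\{X\in\mathcal{Y}:x\in X,\ \mu(X)\subseteq H(U,x)_\alpha\}$; $H(U,x)_\lambda:=\bigcup_{\alpha<\lambda}H(U,x)_\alpha$ for limit $\lambda$; $H(U,x):=\bigcup_\alpha H(U,x)_\alpha$ over all ordinals. (HUx): for all $U,Y\in\mathcal{Y}$ and $x\in Z$, if $x\in\mu(U)$ and $x\in Y-\mu(Y)$ then $\mu(Y)\not\subseteq H(U,x)$. A preferential structure over $Z$ is $\mathcal{Z}=\langle\mathcal{U},\prec\rangle$ with $\mathcal{U}$ a set of pairs $\langle x,i\rangle$, $x\in Z$ (copies of $x$), and $\prec$ an arbitrary binary relation on $\mathcal{U}$. $\mu_{\mathcal{Z}}(X):=\{x\in X:\exists\langle x,i\rangle\in\mathcal{U}\ \neg\exists\langle x',i'\rangle\in\mathcal{U}(x'\in X\wedge\langle x',i'\rangle\prec\langle x,i\rangle)\}$. $\langle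 x,i\rangle\in\mathcal{U}$ with $x\in X$ is minimal in $X$ if no $\langle x',i'\rangle\in\mathcal{U}$ with $x'\in X$ satisfies $\langle x',i'\rangle\prec\langle x,i\rangle$. $\mathcal{Z}$ is $\mathcal{Y}$-smooth iff for every $X\in\mathcal{Y}$ and $\langle x,i\rangle\in\mathcal{U}$ with $x\in X$, either $\langle x,i\rangle$ is minimal in $X$ or there is $\langle x',i'\rangle\prec\langle x,i\rangle$ with $x'\in X$ minimal in $X$. -}

module Defs where

open import Level using (0ℓ)
open import Data.Product using (Σ; ∃; _×_; _,_)
open import Data.Sum using (_⊎_)
open import Relation.Nullary using (¬_)
open import Relation.Binary.PropositionalEquality using (_≡_)
open import Relation.Unary using (Pred; _∈_; _∉_; _⊆_; _≐_)

-- Setting: a set Z, a family 𝒴 of subsets of Z given as  Y : I → Pred Z 0ℓ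
-- (I indexes the members of 𝒴), and μ : I → Pred Z 0ℓ giving μ(Y i).

module _ {Z I : Set} (Y : I → Pred Z 0ℓ) (μ : I → Pred Z 0ℓ) where

  μ⊆ : Set
  μ⊆ = ∀ i → μ i ⊆ Y i

  -- H(U,x): the union over all ordinals of the stages H(U,x)_α is the least
  -- set containing U and closed under the successor step; we define it as
  -- that inductively generated set.
  data H (U : I) (x : Z) : Pred Z 0ℓ where
    H-base : ∀ {z} → z ∈ Y U → H U x z
    H-step : ∀ (j : I) → x ∈ Y j → μ j ⊆ H U x → ∀ {z} → z ∈ Y j → H U x z

  HUx : Set
  HUx = ∀ (U V : I) (x : Z) → x ∈ μ U → x ∈ Y V → x ∉ μ V → ¬ (μ V ⊆ H U x)

record PrefStructure (Z : Set) : Set₁ where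
  field
    𝒰   : Set
    pt  : 𝒰 → Z
    _≺_ : 𝒰 → 𝒰 → Set

module _ {Z : Set} (𝒵 : PrefStructure Z) where
  open PrefStructure 𝒵

  Minimal : Pred Z 0ℓ → 𝒰 → Set
  Minimal X u = pt u ∈ X × ¬ (Σ 𝒰 λ u' → pt u' ∈ X × u' ≺ u)

  μ𝒵 : Pred Z 0ℓ → Pred Z 0ℓ
  μ𝒵 X x = x ∈ X × Σ 𝒰 λ u → pt u ≡ x × ¬ (Σ 𝒰 λ u' → pt u' ∈ X × u' ≺ u)

  Smooth : {I : Set} → (I → Pred Z 0ℓ) → Set
  Smooth Y = ∀ i (u : 𝒰) → pt u ∈ Y i →
             Minimal (Y i) u ⊎ (Σ 𝒰 λ u' → u' ≺ u × Minimal (Y i) u')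

{-# OPTIONS --safe #-}
module Submission where

-- Soundness: a copy u minimal in U stays minimal in all of H(U, pt u), since by smoothness every
-- X added to H through pt u either has u minimal in it or has a minimal copy below u whose point
-- lies in μ(X) ⊆ H. A violation of (HUx) would put such a copy below u.
--
-- Completeness: take one copy ⟨x, U⟩ for each x ∈ μ(U) and let every copy of a point outside
-- H(U, x) lie below ⟨x, U⟩. No choice functions are needed: H(U, x) ⊇ U makes ⟨x, U⟩ minimal in U,
-- and (HUx) supplies the points of μ(X) − H(U, x) that kill the copies of x ∉ μ(X).

open import Defs
open import Level using (0ℓ)
open import Data.Product using (Σ; _×_; _,_; proj₁; proj₂)
open import Data.Sum using (inj₁; inj₂)
open import Relation.Nullary using (¬_; yes; no)
open import Relation.Binary.PropositionalEquality using (refl)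
open import Relation.Unary using (Pred; _≐_; _∈_; _∉_; _⊆_)
open import Axiom.ExcludedMiddle using (ExcludedMiddle)
open import Axiom.DoubleNegationElimination using (DoubleNegationElimination; em⇒dne)

¬∃∉⇒⊆ : ∀ {A : Set} {P Q : Pred A 0ℓ} → DoubleNegationElimination 0ℓ →
         ¬ (Σ A λ z → z ∈ P × z ∉ Q) → P ⊆ Q
¬∃∉⇒⊆ dne ¬∃ {z} z∈P = dne λ z∉Q → ¬∃ (z , z∈P , z∉Q)

minimal⇒μ𝒵 : ∀ {Z} (𝒵 : PrefStructure Z) {X u} → Minimal 𝒵 X u → PrefStructure.pt 𝒵 u ∈ μ𝒵 𝒵 X
minimal⇒μ𝒵 𝒵 (u∈X , none-below) = u∈X , _ , refl , none-below

module Soundness {Z I : Set} (Y : I → Pred Z 0ℓ) (μ : I → Pred Z 0ℓ)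
  (𝒵 : PrefStructure Z) (smooth : Smooth 𝒵 Y) (represents : ∀ i → μ i ≐ μ𝒵 𝒵 (Y i)) where
  open PrefStructure 𝒵

  representable⇒μ⊆ : μ⊆ Y μ
  representable⇒μ⊆ i x∈μ = proj₁ (proj₁ (represents i) x∈μ)

  minimal⇒μ : ∀ {i u} → Minimal 𝒵 (Y i) u → pt u ∈ μ i
  minimal⇒μ {i} u-min = proj₂ (represents i) (minimal⇒μ𝒵 𝒵 {Y i} u-min)

  minimal-in-H : ∀ {U u} → Minimal 𝒵 (Y U) u → Minimal 𝒵 (H Y μ U (pt u)) u
  minimal-in-H {U} {u} (u∈U , none-below-in-U) =
    H-base u∈U , λ (u' , u'∈H , u'≺u) → not-below u'∈H u'≺u
    where
    not-below : ∀ {u'} → pt u' ∈ H Y μ U (pt u) → ¬ (u' ≺ u)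
    not-below (H-base u'∈U) u'≺u = none-below-in-U (_ , u'∈U , u'≺u)
    not-below (H-step j u∈j μj⊆H u'∈j) u'≺u with smooth j u u∈j
    ... | inj₁ (_ , none-below-in-j) = none-below-in-j (_ , u'∈j , u'≺u)
    ... | inj₂ (u'' , u''≺u , u''-min) = not-below (μj⊆H (minimal⇒μ u''-min)) u''≺u

  representable⇒HUx : HUx Y μ
  representable⇒HUx U V x x∈μU x∈V x∉μV μV⊆H with proj₁ (represents U) x∈μU
  ... | u∈U , u , refl , none-below with smooth V u x∈V
  ... | inj₁ u-min-V = x∉μV (minimal⇒μ u-min-V)
  ... | inj₂ (u' , u'≺u , u'-min-V) =
    proj₂ (minimal-in-H (u∈U , none-below)) (u' , μV⊆H (minimal⇒μ u'-min-V) , u'≺u)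

module Completeness (em : ExcludedMiddle 0ℓ) {Z I : Set} (Y : I → Pred Z 0ℓ) (μ : I → Pred Z 0ℓ)
  (μ⊆Y : μ⊆ Y μ) (hux : HUx Y μ) where

  dne : DoubleNegationElimination 0ℓ
  dne = em⇒dne em

  record Copy : Set where
    constructor copy
    field
      index   : I
      point   : Z
      point∈μ : point ∈ μ index
  open Copy

  _≺_ : Copy → Copy → Set
  c' ≺ c = point c' ∉ H Y μ (index c) (point c)

  canonical : PrefStructure Z
  canonical = record { 𝒰 = Copy ; pt = point ; _≺_ = _≺_ }

  minimal-if-⊆H : ∀ {X} c → Y X ⊆ H Y μ (index c) (point c) → point c ∈ Y X →
                  Minimal canonical (Y X) c
  minimal-if-⊆H c X⊆H c∈X = c∈X , λ (c' , c'∈X , c'≺c) → c'≺c (X⊆H c'∈X)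

  copy-minimal : ∀ {X x} (x∈μ : x ∈ μ X) → Minimal canonical (Y X) (copy X x x∈μ)
  copy-minimal {X} x∈μ = minimal-if-⊆H (copy X _ x∈μ) H-base (μ⊆Y X x∈μ)

  none-below⇒μ⊆H : ∀ {X} c → ¬ (Σ Copy λ c' → point c' ∈ Y X × c' ≺ c) →
                   μ X ⊆ H Y μ (index c) (point c)
  none-below⇒μ⊆H {X} c none-below =
    ¬∃∉⇒⊆ dne λ (z , z∈μ , z∉H) → none-below (copy X z z∈μ , μ⊆Y X z∈μ , z∉H)

  canonical-smooth : Smooth canonical Y
  canonical-smooth X c c∈X with em {Σ Z λ z → z ∈ μ X × z ∉ H Y μ (index c) (point c)}
  ... | yes (z , z∈μ , z∉H) = inj₂ (copy X z z∈μ , z∉H , copy-minimal z∈μ)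
  ... | no ¬∃ = inj₁ (minimal-if-⊆H c (H-step X c∈X (¬∃∉⇒⊆ dne ¬∃)) c∈X)

  canonical-represents : ∀ X → μ X ≐ μ𝒵 canonical (Y X)
  canonical-represents X = (λ x∈μ → minimal⇒μ𝒵 canonical {Y X} {copy X _ x∈μ} (copy-minimal x∈μ)) , μ𝒵⊆μ
    where
    μ𝒵⊆μ : μ𝒵 canonical (Y X) ⊆ μ X
    μ𝒵⊆μ (x∈X , c , refl , none-below) = dne λ x∉μ →
      hux (index c) X (point c) (point∈μ c) x∈X x∉μ (none-below⇒μ⊆H c none-below)

proposition2p6 : ExcludedMiddle 0ℓ →
    ∀ {Z I : Set} (Y : I → Pred Z 0ℓ) (μ : I → Pred Z 0ℓ) →
    ((Σ (PrefStructure Z) λ 𝒵 → Smooth 𝒵 Y × (∀ i → μ i ≐ μ𝒵 𝒵 (Y i)))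
      → (μ⊆ Y μ × HUx Y μ))
    × ((μ⊆ Y μ × HUx Y μ)
      → Σ (PrefStructure Z) λ 𝒵 → Smooth 𝒵 Y × (∀ i → μ i ≐ μ𝒵 𝒵 (Y i)))
proposition2p6 em Y μ =
  (λ (𝒵 , smooth , represents) → let open Soundness Y μ 𝒵 smooth represents in
     representable⇒μ⊆ , representable⇒HUx)
  , (λ (μ⊆Y , hux) → let open Completeness em Y μ μ⊆Y hux in
     canonical , canonical-smooth , canonical-represents)
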